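{- For all integers $k,n\geq 1$, $E_{\pi\in S_{n}}[MHS_{k}(\pi)]\geq H_{n}=\sum_{j=1}^n \frac1j$, where $\pi$ is a uniformly random permutation of $\{1,\dots,n\}$ regarded as the sequence $(\pi(1),\ldots,\pi(n))$.
   Context: A $k$-ary tree is a finite set of words over $\{1,\ldots,k\}$ closed under prefixes and under replacing the last letter by a smaller letter. A finite sequence $X=(X_{0},\ldots, X_{n-1})$ is $k$-heapable if there is a $k$-ary tree whose nodes are labeled bijectively by $X_0,\dots,X_{n-1}$ such that for every non-root node labeled $X_{i}$ with parent labeled $X_{j}$, $X_{j}\leq X_{i}$ and $j<i$. $MHS_{k}(X)$ is the smallest number of (not necessarily contiguous) $k$-heapable subsequences into which $X$ can be partitioned. -}

module Defs where

open import Data.Nat as ℕ using (ℕ; zero; suc; _≤_; _<_)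
open import Data.Fin as Fin using (Fin)
open import Data.List using (List; []; _∷_; _++_; [_]; length; lookup; map; concatMap; filter; upTo; sum; allFin; foldr)
open import Data.Product using (Σ; _×_; _,_; ∃)
open import Relation.Binary.PropositionalEquality using (_≡_)
open import Relation.Nullary using (¬_)
open import Data.Integer using (+_)
open import Data.Rational as ℚ using (ℚ)
import Data.List.Relation.Unary.Unique.DecPropositional as UniqueDec
open import Function.Definitions using (Injective)

-- k-ary trees
-- Words over the alphabet {1,…,k}; the letter i+1 is represented by i : Fin k,
-- and letters are ordered by Fin's _<_.
Word : ℕ → Set
Word k = List (Fin k)

-- A finite set of words, presented as the image of a function from Fin L.
-- It is a k-ary tree iff it is closed under prefixes (it suffices to close
-- under deleting the last letter) and under replacing the last letter by a
-- smaller letter.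
IsKaryTree : (k L : ℕ) → (Fin L → Word k) → Set
IsKaryTree k L w =
  ∀ (i : Fin L) (u : Word k) (a : Fin k) → w i ≡ u ++ [ a ] →
    (∃ λ j → w j ≡ u) × (∀ (b : Fin k) → Fin._<_ b a → ∃ λ j → w j ≡ u ++ [ b ])

-- k-heapability of a finite sequence X = (X_0,…,X_{L-1}) (given as a list):
-- there is a labelling of the nodes of a k-ary tree bijectively by the positions
-- 0,…,L-1 (w i is the node labelled X_i; w injective, tree = image of w) such
-- that whenever the node labelled X_i has parent labelled X_j, X_j ≤ X_i and j < i.
Heapable : ℕ → List ℕ → Set
Heapable k X =
  Σ (Fin (length X) → Word k) λ w →
    Injective _≡_ _≡_ w ×
    IsKaryTree k (length X) w ×
    (∀ (i j : Fin (length X)) (a : Fin k) → w i ≡ w j ++ [ a ] →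
       (lookup X j ≤ lookup X i) × (Fin._<_ j i))

subseq : (X : List ℕ) {m : ℕ} → (Fin (length X) → Fin m) → Fin m → List ℕ
subseq X c t = map (lookup X) (filter (λ i → c i Fin.≟ t) (allFin (length X)))

PartitionableInto : ℕ → List ℕ → ℕ → Set
PartitionableInto k X m =
  Σ (Fin (length X) → Fin m) λ c → ∀ (t : Fin m) → Heapable k (subseq X c t)

IsMHS : ℕ → List ℕ → ℕ → Set
IsMHS k X m =
  PartitionableInto k X m × (∀ m′ → PartitionableInto k X m′ → m ≤ m′)

seqsOver : List ℕ → ℕ → List (List ℕ)
seqsOver vs zero = [] ∷ []
seqsOver vs (suc l) = concatMap (λ xs → map (_∷ xs) vs) (seqsOver vs l)

-- the sequences of length n with entries in {1,…,n} that are pairwise distinct,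
-- i.e. exactly the permutations of {1,…,n} (each listed once)
perms : ℕ → List (List ℕ)
perms n = filter (UniqueDec.unique? ℕ._≟_) (seqsOver (map suc (upTo n)) n)

harmonic : ℕ → ℚ
harmonic n = foldr ℚ._+_ ℚ.0ℚ (map (λ j → (+ 1) ℚ./ suc j) (upTo n))

-- arithmetic mean of a list of naturals (the expectation under the uniform
-- distribution on the list); the empty list gets mean 0 (never used here)
mean : List ℕ → ℚ
mean [] = ℚ.0ℚ
mean (x ∷ xs) = (+ foldr ℕ._+_ 0 (x ∷ xs)) ℚ./ suc (length xs)

module Submission where

-- Call an entry of a sequence a left-to-right minimum if it is smaller than
-- every earlier entry.  In a heapable sequence every entry but the first has
-- an earlier entry ≤ it (its parent), so two left-to-right minima never lie
-- in a common heapable subsequence; by pigeonhole MHS_k(π) is at least the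
-- number of left-to-right minima of π (records≤parts).  Splitting the orderings of a finite
-- set W by their first entry gives a recurrence (Σinj-records) for the total
-- number recordSum m a of minima below a bound b, where m = |W| and a is the
-- number of elements of W below b; it is solved by
-- recordSum m a · a! = m! · a!·H_a (recordSum-closed).  For W = {1,…,n} and
-- b = n+1 the total is n!·H_n, and dividing by n! gives the theorem.

open import Defs
open import Data.Nat as ℕ using (ℕ; zero; suc; _+_; _*_; _∸_; _!; pred; _≤_; _<_; z≤n; s≤s; _≡ᵇ_; _<ᵇ_)
open import Data.Nat.Properties
open import Data.Nat.Tactic.RingSolver
open import Data.Bool using (Bool; true; false; _∧_; not; if_then_else_)
open import Data.Fin as Fin using (Fin; toℕ; cast)
import Data.Fin.Properties as FinP
open import Data.Integer as ℤ using () renaming (+_ to pos)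
import Data.Integer.Properties as ℤP
open import Data.Rational as ℚ using (ℚ)
import Data.Rational.Properties as ℚP
open import Data.Rational.Unnormalised as ℚᵘ using (mkℚᵘ; *≡*; *≤*)
import Data.Rational.Unnormalised.Properties as ℚᵘP
open import Data.List using (List; []; _∷_; _++_; [_]; length; lookup; map; concatMap; filter; foldr; upTo; allFin; initLast; _∷ʳ′_)
import Data.List.Properties as LP
open import Data.List.Relation.Unary.All as All using (All; []; _∷_; all?)
import Data.List.Relation.Unary.All.Properties as AllP
open import Data.List.Relation.Unary.AllPairs as AllPairs using (AllPairs; []; _∷_)
import Data.List.Relation.Unary.AllPairs.Properties as AllPairsP
open import Data.List.Relation.Unary.Any as Any using (here; there)
import Data.List.Relation.Unary.Any.Properties as AnyP
open import Data.List.Membership.Propositional using (_∈_)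
import Data.List.Membership.Propositional.Properties as ∈P
open import Data.List.Relation.Unary.Unique.Propositional using (Unique)
import Data.List.Relation.Unary.Unique.Propositional.Properties as UniqueP
import Data.List.Relation.Unary.Unique.DecPropositional as UniqueDec
open import Data.Product using (Σ-syntax; _×_; _,_; proj₁; proj₂)
open import Data.Sum using (_⊎_; inj₁; inj₂)
open import Function using (_∘_)
open import Relation.Nullary using (¬_; does; ¬?; ofʸ; ofⁿ; proof; contradiction)
open import Relation.Unary using (Decidable)
open import Relation.Binary using (tri<; tri≈; tri>)
open import Relation.Binary.PropositionalEquality hiding ([_])

private variable
  A B : Set

-- Finite sums.  Σ L f = Σ_{x ∈ L} f x is written as a fold, so that it unfolds
-- like the sums in mean; guarded terms b ?⇒ n express sums over sub-lists.
Σ : List A → (A → ℕ) → ℕ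
Σ L f = foldr _+_ 0 (map f L)

infixr 3 _?⇒_
_?⇒_ : Bool → ℕ → ℕ
true ?⇒ n = n
false ?⇒ n = 0

Σ-cong : (L : List A) {f g : A → ℕ} → (∀ x → f x ≡ g x) → Σ L f ≡ Σ L g
Σ-cong [] e = refl
Σ-cong (x ∷ L) e = cong₂ _+_ (e x) (Σ-cong L e)

Σ-cong-∈ : (L : List A) {f g : A → ℕ} → (∀ {x} → x ∈ L → f x ≡ g x) → Σ L f ≡ Σ L g
Σ-cong-∈ [] e = refl
Σ-cong-∈ (x ∷ L) e = cong₂ _+_ (e (here refl)) (Σ-cong-∈ L (λ x∈L → e (there x∈L)))

Σ-zero : (L : List A) → Σ L (λ _ → 0) ≡ 0
Σ-zero [] = refl
Σ-zero (x ∷ L) = Σ-zero L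

Σ-+ : (L : List A) (f g : A → ℕ) → Σ L (λ x → f x + g x) ≡ Σ L f + Σ L g
Σ-+ [] f g = refl
Σ-+ (x ∷ L) f g rewrite Σ-+ L f g = shuffle (f x) (g x) (Σ L f) (Σ L g)
  where shuffle : ∀ a b c d → a + b + (c + d) ≡ a + c + (b + d)
        shuffle = solve-∀

Σ-const : (L : List A) (c : ℕ) → Σ L (λ _ → c) ≡ length L * c
Σ-const [] c = refl
Σ-const (x ∷ L) c = cong (c +_) (Σ-const L c)

Σ-*ʳ : (L : List A) (f : A → ℕ) (c : ℕ) → Σ L (λ x → f x * c) ≡ Σ L f * c
Σ-*ʳ [] f c = refl
Σ-*ʳ (x ∷ L) f c rewrite Σ-*ʳ L f c = sym (*-distribʳ-+ c (f x) (Σ L f))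

Σ-++ : (L M : List A) (f : A → ℕ) → Σ (L ++ M) f ≡ Σ L f + Σ M f
Σ-++ [] M f = refl
Σ-++ (x ∷ L) M f rewrite Σ-++ L M f = sym (+-assoc (f x) (Σ L f) (Σ M f))

Σ-swap : (L : List A) (M : List B) (f : A → B → ℕ) →
  Σ L (λ a → Σ M (f a)) ≡ Σ M (λ b → Σ L (λ a → f a b))
Σ-swap [] M f = sym (Σ-zero M)
Σ-swap (x ∷ L) M f rewrite Σ-swap L M f = sym (Σ-+ M (f x) (λ b → Σ L (λ a → f a b)))

Σ-map : (h : B → A) (L : List B) (f : A → ℕ) → Σ (map h L) f ≡ Σ L (λ x → f (h x))
Σ-map h L f = cong (foldr _+_ 0) (sym (LP.map-∘ L))

Σ-concatMap : (h : B → List A) (L : List B) (f : A → ℕ) →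
  Σ (concatMap h L) f ≡ Σ L (λ x → Σ (h x) f)
Σ-concatMap h [] f = refl
Σ-concatMap h (x ∷ L) f rewrite Σ-++ (h x) (concatMap h L) f = cong (Σ (h x) f +_) (Σ-concatMap h L f)

Σ-upTo-suc : ∀ a (f : ℕ → ℕ) → Σ (upTo (suc a)) f ≡ Σ (upTo a) f + f a
Σ-upTo-suc a f = begin
  Σ (upTo (suc a)) f        ≡⟨ cong (λ L → Σ L f) (sym (LP.upTo-∷ʳ a)) ⟩
  Σ (upTo a ++ [ a ]) f     ≡⟨ Σ-++ (upTo a) [ a ] f ⟩
  Σ (upTo a) f + (f a + 0)  ≡⟨ cong (Σ (upTo a) f +_) (+-identityʳ (f a)) ⟩
  Σ (upTo a) f + f a        ∎
  where open ≡-Reasoning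

?⇒-∧ : ∀ a b n → ((a ∧ b) ?⇒ n) ≡ (a ?⇒ b ?⇒ n)
?⇒-∧ true b n = refl
?⇒-∧ false b n = refl

?⇒-swap : ∀ a b n → (a ?⇒ b ?⇒ n) ≡ (b ?⇒ a ?⇒ n)
?⇒-swap true b n = refl
?⇒-swap false true n = refl
?⇒-swap false false n = refl

?⇒-+ : ∀ a m n → (a ?⇒ m + n) ≡ (a ?⇒ m) + (a ?⇒ n)
?⇒-+ true m n = refl
?⇒-+ false m n = refl

?⇒-* : ∀ a n → (a ?⇒ n) ≡ (a ?⇒ 1) * n
?⇒-* true n = sym (+-identityʳ n)
?⇒-* false n = refl

Σ-?⇒ : (L : List A) (b : Bool) (f : A → ℕ) → Σ L (λ x → b ?⇒ f x) ≡ (b ?⇒ Σ L f)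
Σ-?⇒ L true f = refl
Σ-?⇒ L false f = Σ-zero L

Σ-?⇒-const : (L : List A) (p : A → Bool) (c : ℕ) → Σ L (λ x → p x ?⇒ c) ≡ Σ L (λ x → p x ?⇒ 1) * c
Σ-?⇒-const L p c = trans (Σ-cong L (λ x → ?⇒-* (p x) c)) (Σ-*ʳ L _ c)

Σ-?⇒-not : (L : List A) (p : A → Bool) → Σ L (λ x → p x ?⇒ 1) + Σ L (λ x → not (p x) ?⇒ 1) ≡ length L
Σ-?⇒-not L p = begin
  Σ L (λ x → p x ?⇒ 1) + Σ L (λ x → not (p x) ?⇒ 1) ≡⟨ sym (Σ-+ L _ _) ⟩
  Σ L (λ x → (p x ?⇒ 1) + (not (p x) ?⇒ 1))         ≡⟨ Σ-cong L (λ x → one (p x)) ⟩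
  Σ L (λ _ → 1)                                      ≡⟨ Σ-const L 1 ⟩
  length L * 1                                       ≡⟨ *-identityʳ (length L) ⟩
  length L                                           ∎
  where
  open ≡-Reasoning
  one : ∀ a → (a ?⇒ 1) + (not a ?⇒ 1) ≡ 1
  one true = refl
  one false = refl

Σ-mono : (L : List A) {f g : A → ℕ} → All (λ x → f x ≤ g x) L → Σ L f ≤ Σ L g
Σ-mono [] [] = z≤n
Σ-mono (x ∷ L) (fx≤gx ∷ f≤g) = +-mono-≤ fx≤gx (Σ-mono L f≤g)

Σ-filter : {P : A → Set} (P? : Decidable P) (L : List A) (f : A → ℕ) →
  Σ (filter P? L) f ≡ Σ L (λ x → does (P? x) ?⇒ f x)
Σ-filter P? [] f = refl
Σ-filter P? (x ∷ L) f with does (P? x)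
... | true = cong (f x +_) (Σ-filter P? L f)
... | false = Σ-filter P? L f

-- fresh y xs: y does not occur in xs; distinct xs: xs has no repetition.
-- These are the Boolean tests of perms; distinct (y ∷ xs) unfolds to
-- fresh y xs ∧ distinct xs.
fresh : ℕ → List ℕ → Bool
fresh y xs = does (all? (λ x → ¬? (y ≟ x)) xs)

distinct : List ℕ → Bool
distinct xs = does (UniqueDec.unique? _≟_ xs)

_∖_ : List ℕ → ℕ → List ℕ
W ∖ y = filter (λ x → ¬? (y ≟ x)) W

Σinj : List ℕ → ℕ → (List ℕ → ℕ) → ℕ
Σinj W l F = Σ (seqsOver W l) (λ xs → distinct xs ?⇒ F xs)

Σ-seqsOver-suc : ∀ W l (F : List ℕ → ℕ) →
  Σ (seqsOver W (suc l)) F ≡ Σ (seqsOver W l) (λ xs → Σ W (λ y → F (y ∷ xs)))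
Σ-seqsOver-suc W l F =
  trans (Σ-concatMap (λ xs → map (_∷ xs) W) (seqsOver W l) F)
        (Σ-cong (seqsOver W l) (λ xs → Σ-map (_∷ xs) W F))

Σ-fresh : ∀ y W l (G : List ℕ → ℕ) →
  Σ (seqsOver W l) (λ xs → fresh y xs ?⇒ G xs) ≡ Σ (seqsOver (W ∖ y) l) G
Σ-fresh y W zero G = refl
Σ-fresh y W (suc l) G = begin
  Σ (seqsOver W (suc l)) (λ xs → fresh y xs ?⇒ G xs)
    ≡⟨ Σ-seqsOver-suc W l _ ⟩
  Σ (seqsOver W l) (λ xs → Σ W (λ x → (not (y ≡ᵇ x) ∧ fresh y xs) ?⇒ G (x ∷ xs)))
    ≡⟨ Σ-cong (seqsOver W l) (λ xs → Σ-cong W (λ x → guardOutside x xs)) ⟩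
  Σ (seqsOver W l) (λ xs → Σ W (λ x → fresh y xs ?⇒ not (y ≡ᵇ x) ?⇒ G (x ∷ xs)))
    ≡⟨ Σ-cong (seqsOver W l) (λ xs → Σ-?⇒ W (fresh y xs) _) ⟩
  Σ (seqsOver W l) (λ xs → fresh y xs ?⇒ Σ W (λ x → not (y ≡ᵇ x) ?⇒ G (x ∷ xs)))
    ≡⟨ Σ-cong (seqsOver W l) (λ xs → cong (fresh y xs ?⇒_) (sym (Σ-filter (λ x → ¬? (y ≟ x)) W _))) ⟩
  Σ (seqsOver W l) (λ xs → fresh y xs ?⇒ Σ (W ∖ y) (λ x → G (x ∷ xs)))
    ≡⟨ Σ-fresh y W l _ ⟩
  Σ (seqsOver (W ∖ y) l) (λ xs → Σ (W ∖ y) (λ x → G (x ∷ xs)))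
    ≡⟨ sym (Σ-seqsOver-suc (W ∖ y) l G) ⟩
  Σ (seqsOver (W ∖ y) (suc l)) G ∎
  where
  open ≡-Reasoning
  guardOutside : ∀ x xs → ((not (y ≡ᵇ x) ∧ fresh y xs) ?⇒ G (x ∷ xs)) ≡ (fresh y xs ?⇒ not (y ≡ᵇ x) ?⇒ G (x ∷ xs))
  guardOutside x xs = trans (?⇒-∧ (not (y ≡ᵇ x)) (fresh y xs) _) (?⇒-swap (not (y ≡ᵇ x)) (fresh y xs) _)

Σinj-suc : ∀ W l (F : List ℕ → ℕ) →
  Σinj W (suc l) F ≡ Σ W (λ y → Σinj (W ∖ y) l (λ ys → F (y ∷ ys)))
Σinj-suc W l F = begin
  Σinj W (suc l) F
    ≡⟨ Σ-seqsOver-suc W l _ ⟩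
  Σ (seqsOver W l) (λ xs → Σ W (λ y → (fresh y xs ∧ distinct xs) ?⇒ F (y ∷ xs)))
    ≡⟨ Σ-cong (seqsOver W l) (λ xs → Σ-cong W (λ y → ?⇒-∧ (fresh y xs) (distinct xs) _)) ⟩
  Σ (seqsOver W l) (λ xs → Σ W (λ y → fresh y xs ?⇒ distinct xs ?⇒ F (y ∷ xs)))
    ≡⟨ Σ-swap (seqsOver W l) W _ ⟩
  Σ W (λ y → Σ (seqsOver W l) (λ xs → fresh y xs ?⇒ distinct xs ?⇒ F (y ∷ xs)))
    ≡⟨ Σ-cong W (λ y → Σ-fresh y W l _) ⟩
  Σ W (λ y → Σinj (W ∖ y) l (λ ys → F (y ∷ ys))) ∎
  where open ≡-Reasoning

length-∖ : ∀ {y W} → Unique W → y ∈ W → suc (length (W ∖ y)) ≡ length W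
length-∖ {y} {x ∷ W} (x∉W ∷ uW) y∈xW with y ≡ᵇ x | proof (y ≟ x)
... | true | ofʸ refl = cong (suc ∘ length) (LP.filter-all (λ x → ¬? (y ≟ x)) x∉W)
... | false | ofⁿ y≢x with y∈xW
...   | here y≡x = contradiction y≡x y≢x
...   | there y∈W = cong suc (length-∖ uW y∈W)

remove-member : ∀ {m y W} → Unique W → length W ≡ suc m → y ∈ W → Unique (W ∖ y) × length (W ∖ y) ≡ m
remove-member uW lW y∈W = UniqueP.filter⁺ _ uW , suc-injective (trans (length-∖ uW y∈W) lW)

Σinj-count : ∀ m W → Unique W → length W ≡ m → Σinj W m (λ _ → 1) ≡ m !
Σinj-count zero W uW lW = refl
Σinj-count (suc m) W uW lW = begin
  Σinj W (suc m) (λ _ → 1)              ≡⟨ Σinj-suc W m (λ _ → 1) ⟩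
  Σ W (λ y → Σinj (W ∖ y) m (λ _ → 1))  ≡⟨ Σ-cong-∈ W orderingsOfRest ⟩
  Σ W (λ _ → m !)                       ≡⟨ Σ-const W (m !) ⟩
  length W * m !                        ≡⟨ cong (_* m !) lW ⟩
  suc m !                               ∎
  where
  open ≡-Reasoning
  orderingsOfRest : ∀ {y} → y ∈ W → Σinj (W ∖ y) m (λ _ → 1) ≡ m !
  orderingsOfRest {y} y∈W = let uW′ , lW′ = remove-member uW lW y∈W in Σinj-count m (W ∖ y) uW′ lW′

-- Left-to-right minima and their total over all orderings.

-- records b X: the number of left-to-right minima of X below b, i.e. of
-- entries smaller than b and than every earlier entry.
records : ℕ → List ℕ → ℕ
records b [] = 0
records b (y ∷ ys) = if y <ᵇ b then suc (records y ys) else records b ys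

below : ℕ → List ℕ → ℕ
below b W = Σ W (λ x → x <ᵇ b ?⇒ 1)

occurrences : ℕ → List ℕ → ℕ
occurrences y W = Σ W (λ x → y ≡ᵇ x ?⇒ 1)

occurrences-∉ : ∀ {y} W → All (λ x → y ≢ x) W → occurrences y W ≡ 0
occurrences-∉ [] [] = refl
occurrences-∉ {y} (x ∷ W) (y≢x ∷ y∉W) with y ≡ᵇ x | proof (y ≟ x)
... | true | ofʸ y≡x = contradiction y≡x y≢x
... | false | _ = occurrences-∉ W y∉W

occurrences-≤1 : ∀ y {W} → Unique W → occurrences y W ≤ 1
occurrences-≤1 y [] = z≤n
occurrences-≤1 y {x ∷ W} (x∉W ∷ uW) with y ≡ᵇ x | proof (y ≟ x)
... | true | ofʸ refl = ≤-reflexive (cong suc (occurrences-∉ W x∉W))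
... | false | _ = occurrences-≤1 y uW

below-∖ : ∀ b {y} W → ¬ y < b → below b (W ∖ y) ≡ below b W
below-∖ b {y} W y≮b = trans (Σ-filter (λ x → ¬? (y ≟ x)) W _) (Σ-cong W keep)
  where
  keep : ∀ x → (not (y ≡ᵇ x) ?⇒ x <ᵇ b ?⇒ 1) ≡ (x <ᵇ b ?⇒ 1)
  keep x with y ≡ᵇ x | proof (y ≟ x)
  ... | false | _ = refl
  ... | true | ofʸ refl with y <ᵇ b | <ᵇ-reflects-< y b
  ...   | true | ofʸ y<b = contradiction y<b y≮b
  ...   | false | _ = refl

below-all : ∀ {b} W → All (_< b) W → below b W ≡ length W
below-all [] [] = refl
below-all {b} (x ∷ W) (x<b ∷ W<b) with x <ᵇ b | <ᵇ-reflects-< x b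
... | true | _ = cong suc (below-all W W<b)
... | false | ofⁿ x≮b = contradiction x<b x≮b

<ᵇ-suc : ∀ y b n → (y <ᵇ suc b ?⇒ n) ≡ (y <ᵇ b ?⇒ n) + (b ≡ᵇ y ?⇒ n)
<ᵇ-suc zero zero n = refl
<ᵇ-suc zero (suc b) n = sym (+-identityʳ n)
<ᵇ-suc (suc y) zero n = refl
<ᵇ-suc (suc y) (suc b) n = <ᵇ-suc y b n

below-suc : ∀ b W → below (suc b) W ≡ below b W + occurrences b W
below-suc b W = trans (Σ-cong W (λ y → <ᵇ-suc y b 1)) (Σ-+ W _ _)

-- In a repetition-free W, the elements below b have the ranks 0,…,a-1,
-- where a = below b W (the rank of y being below y W).
Σ-ranks : ∀ {W} → Unique W → ∀ b (h : ℕ → ℕ) →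
  Σ W (λ y → y <ᵇ b ?⇒ h (below y W)) ≡ Σ (upTo (below b W)) h
Σ-ranks {W} uW zero h = trans (Σ-zero W) (cong (λ c → Σ (upTo c) h) (sym (Σ-zero W)))
Σ-ranks {W} uW (suc b) h = begin
  Σ W (λ y → y <ᵇ suc b ?⇒ h (below y W))
    ≡⟨ Σ-cong W (λ y → <ᵇ-suc y b _) ⟩
  Σ W (λ y → (y <ᵇ b ?⇒ h (below y W)) + (b ≡ᵇ y ?⇒ h (below y W)))
    ≡⟨ Σ-+ W _ _ ⟩
  Σ W (λ y → y <ᵇ b ?⇒ h (below y W)) + Σ W (λ y → b ≡ᵇ y ?⇒ h (below y W))
    ≡⟨ cong₂ _+_ (Σ-ranks uW b h) (Σ-cong W rankOfb) ⟩
  Σ (upTo a) h + Σ W (λ y → b ≡ᵇ y ?⇒ h a)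
    ≡⟨ cong (Σ (upTo a) h +_) (Σ-?⇒-const W (b ≡ᵇ_) (h a)) ⟩
  Σ (upTo a) h + occurrences b W * h a
    ≡⟨ extend (occurrences b W) (occurrences-≤1 b uW) ⟩
  Σ (upTo (a + occurrences b W)) h
    ≡⟨ cong (λ c → Σ (upTo c) h) (sym (below-suc b W)) ⟩
  Σ (upTo (below (suc b) W)) h ∎
  where
  open ≡-Reasoning
  a = below b W
  rankOfb : ∀ y → (b ≡ᵇ y ?⇒ h (below y W)) ≡ (b ≡ᵇ y ?⇒ h a)
  rankOfb y with b ≡ᵇ y | proof (b ≟ y)
  ... | true | ofʸ refl = refl
  ... | false | _ = refl
  extend : ∀ e → e ≤ 1 → Σ (upTo a) h + e * h a ≡ Σ (upTo (a + e)) h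
  extend zero _ = trans (+-identityʳ _) (cong (λ c → Σ (upTo c) h) (sym (+-identityʳ a)))
  extend (suc zero) _ = begin
    Σ (upTo a) h + (h a + 0) ≡⟨ cong (Σ (upTo a) h +_) (+-identityʳ (h a)) ⟩
    Σ (upTo a) h + h a       ≡⟨ sym (Σ-upTo-suc a h) ⟩
    Σ (upTo (suc a)) h       ≡⟨ cong (λ c → Σ (upTo c) h) (+-comm 1 a) ⟩
    Σ (upTo (a + 1)) h       ∎
  extend (suc (suc _)) (s≤s ())

-- recordSum m a: the total number of left-to-right minima below b, summed
-- over all orderings of an m-element set with exactly a elements below b.
-- Recurrence: if the first entry y is below b (a choices; y has rank r < a)
-- it is a minimum, counted once in each of the m! orderings of the rest, and
-- the rest contributes recordSum m r; otherwise (m+1-a choices) the rest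
-- still has a elements below b.
recordSum : ℕ → ℕ → ℕ
recordSum zero a = 0
recordSum (suc m) a = a * m ! + Σ (upTo a) (recordSum m) + (suc m ∸ a) * recordSum m a

RecordsFormula : ℕ → Set
RecordsFormula m = ∀ W → Unique W → length W ≡ m → ∀ b → Σinj W m (records b) ≡ recordSum m (below b W)

-- The orderings of W starting with y, given the formula one level down: if
-- y < b, y is a minimum and the rest counts its minima below y (whose rank in
-- W ∖ y is that in W); otherwise the rest counts its minima below b.
records-firstEntry : ∀ m → RecordsFormula m → ∀ W → Unique W → length W ≡ suc m → ∀ b {y} → y ∈ W →
  Σinj (W ∖ y) m (λ ys → records b (y ∷ ys))
    ≡ (y <ᵇ b ?⇒ m ! + recordSum m (below y W)) + (not (y <ᵇ b) ?⇒ recordSum m (below b W))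
records-firstEntry m formula W uW lW b {y} y∈W with y <ᵇ b | <ᵇ-reflects-< y b | remove-member uW lW y∈W
... | true | _ | uW′ , lW′ = begin
  Σinj (W ∖ y) m (λ ys → suc (records y ys))
    ≡⟨ Σ-cong (seqsOver (W ∖ y) m) (λ xs → ?⇒-+ (distinct xs) 1 _) ⟩
  Σ (seqsOver (W ∖ y) m) (λ xs → (distinct xs ?⇒ 1) + (distinct xs ?⇒ records y xs))
    ≡⟨ Σ-+ (seqsOver (W ∖ y) m) _ _ ⟩
  Σinj (W ∖ y) m (λ _ → 1) + Σinj (W ∖ y) m (records y)
    ≡⟨ cong₂ _+_ (Σinj-count m (W ∖ y) uW′ lW′) (formula (W ∖ y) uW′ lW′ y) ⟩
  m ! + recordSum m (below y (W ∖ y))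
    ≡⟨ cong (λ c → m ! + recordSum m c) (below-∖ y W (<-irrefl refl)) ⟩
  m ! + recordSum m (below y W)
    ≡⟨ sym (+-identityʳ _) ⟩
  m ! + recordSum m (below y W) + 0 ∎
  where open ≡-Reasoning
... | false | ofⁿ y≮b | uW′ , lW′ =
  trans (formula (W ∖ y) uW′ lW′ b) (cong (recordSum m) (below-∖ b W y≮b))

-- By induction on m: sum records-firstEntry over the first entry y; by
-- Σ-ranks the entries y < b contribute recordSum m r for each rank r < a.
Σinj-records : ∀ m → RecordsFormula m
Σinj-records zero W uW lW b = refl
Σinj-records (suc m) W uW lW b = begin
  Σinj W (suc m) (records b)
    ≡⟨ Σinj-suc W m (records b) ⟩
  Σ W (λ y → Σinj (W ∖ y) m (λ ys → records b (y ∷ ys)))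
    ≡⟨ Σ-cong-∈ W (records-firstEntry m (Σinj-records m) W uW lW b) ⟩
  Σ W (λ y → (y <ᵇ b ?⇒ m ! + recordSum m (below y W)) + (not (y <ᵇ b) ?⇒ recordSum m a))
    ≡⟨ Σ-+ W _ _ ⟩
  Σ W (λ y → y <ᵇ b ?⇒ m ! + recordSum m (below y W)) + Σ W (λ y → not (y <ᵇ b) ?⇒ recordSum m a)
    ≡⟨ cong (_+ Σ W (λ y → not (y <ᵇ b) ?⇒ recordSum m a)) (trans (Σ-cong W (λ y → ?⇒-+ (y <ᵇ b) _ _)) (Σ-+ W _ _)) ⟩
  Σ W (λ y → y <ᵇ b ?⇒ m !) + Σ W (λ y → y <ᵇ b ?⇒ recordSum m (below y W))
    + Σ W (λ y → not (y <ᵇ b) ?⇒ recordSum m a)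
    ≡⟨ cong₂ _+_ (cong₂ _+_ (Σ-?⇒-const W (_<ᵇ b) (m !)) (Σ-ranks uW b (recordSum m)))
                 (Σ-?⇒-const W (λ y → not (y <ᵇ b)) (recordSum m a)) ⟩
  a * m ! + Σ (upTo a) (recordSum m) + Σ W (λ y → not (y <ᵇ b) ?⇒ 1) * recordSum m a
    ≡⟨ cong (λ c → a * m ! + Σ (upTo a) (recordSum m) + c * recordSum m a) notBelow ⟩
  recordSum (suc m) a ∎
  where
  open ≡-Reasoning
  a = below b W
  notBelow : Σ W (λ y → not (y <ᵇ b) ?⇒ 1) ≡ suc m ∸ a
  notBelow = begin
    Σ W (λ y → not (y <ᵇ b) ?⇒ 1)         ≡⟨ sym (m+n∸m≡n a _) ⟩
    a + Σ W (λ y → not (y <ᵇ b) ?⇒ 1) ∸ a ≡⟨ cong (_∸ a) (trans (Σ-?⇒-not W (_<ᵇ b)) lW) ⟩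
    suc m ∸ a                              ∎

-- The closed form of recordSum.

-- hNum a = a!·H_a and hSumNum a = a!·(H_0 + … + H_{a-1}), as natural numbers.
hNum : ℕ → ℕ
hNum zero = 0
hNum (suc a) = hNum a * suc a + a !

hSumNum : ℕ → ℕ
hSumNum zero = 0
hSumNum (suc a) = suc a * (hSumNum a + hNum a)

hSumNum-closed : ∀ a → a * a ! + hSumNum a ≡ a * hNum a
hSumNum-closed zero = refl
hSumNum-closed (suc a) = begin
  suc a * (suc a * a !) + suc a * (hSumNum a + hNum a) ≡⟨ regroup a (a !) (hSumNum a) (hNum a) ⟩
  suc a * (a ! + (a * a ! + hSumNum a) + hNum a)       ≡⟨ cong (λ t → suc a * (a ! + t + hNum a)) (hSumNum-closed a) ⟩
  suc a * (a ! + a * hNum a + hNum a)                  ≡⟨ collect a (a !) (hNum a) ⟩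
  suc a * (hNum a * suc a + a !)                       ∎
  where
  open ≡-Reasoning
  regroup : ∀ a f X H → suc a * (suc a * f) + suc a * (X + H) ≡ suc a * (f + (a * f + X) + H)
  regroup = solve-∀
  collect : ∀ a f H → suc a * (f + a * H + H) ≡ suc a * (H * suc a + f)
  collect = solve-∀

-- The closed form recordSum m a = m!·H_a, cleared of denominators.
ClosedForm : ℕ → Set
ClosedForm m = ∀ a → a ≤ m → recordSum m a * a ! ≡ m ! * hNum a

Σ-closedForm : ∀ m → ClosedForm m → ∀ a → a ≤ suc m →
  Σ (upTo a) (recordSum m) * a ! ≡ m ! * hSumNum a
Σ-closedForm m closed zero _ = sym (*-zeroʳ (m !))
Σ-closedForm m closed (suc a) (s≤s a≤m) = begin
  Σ (upTo (suc a)) (recordSum m) * (suc a * a !)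
    ≡⟨ cong (_* (suc a * a !)) (Σ-upTo-suc a (recordSum m)) ⟩
  (Σ (upTo a) (recordSum m) + recordSum m a) * (suc a * a !)
    ≡⟨ distribute a (Σ (upTo a) (recordSum m)) (recordSum m a) (a !) ⟩
  suc a * (Σ (upTo a) (recordSum m) * a ! + recordSum m a * a !)
    ≡⟨ cong₂ (λ s t → suc a * (s + t)) (Σ-closedForm m closed a (m≤n⇒m≤1+n a≤m)) (closed a a≤m) ⟩
  suc a * (m ! * hSumNum a + m ! * hNum a)
    ≡⟨ factor a (m !) (hSumNum a) (hNum a) ⟩
  m ! * (suc a * (hSumNum a + hNum a)) ∎
  where
  open ≡-Reasoning
  distribute : ∀ a S F f → (S + F) * (suc a * f) ≡ suc a * (S * f + F * f)
  distribute = solve-∀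
  factor : ∀ a M X H → suc a * (M * X + M * H) ≡ M * (suc a * (X + H))
  factor = solve-∀

recordSum-closed : ∀ m → ClosedForm m
recordSum-closed zero zero _ = refl
recordSum-closed (suc m) a a≤m+1 = begin
  (a * m ! + Σ (upTo a) (recordSum m) + k * recordSum m a) * a !
    ≡⟨ expand a (m !) (a !) (Σ (upTo a) (recordSum m)) k (recordSum m a) ⟩
  m ! * (a * a !) + Σ (upTo a) (recordSum m) * a ! + k * (recordSum m a * a !)
    ≡⟨ cong₂ (λ s t → m ! * (a * a !) + s + t) (Σ-closedForm m closed a a≤m+1) lastTerm ⟩
  m ! * (a * a !) + m ! * hSumNum a + k * (m ! * hNum a)
    ≡⟨ cong (_+ k * (m ! * hNum a)) (sym (*-distribˡ-+ (m !) (a * a !) (hSumNum a))) ⟩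
  m ! * (a * a ! + hSumNum a) + k * (m ! * hNum a)
    ≡⟨ cong (λ t → m ! * t + k * (m ! * hNum a)) (hSumNum-closed a) ⟩
  m ! * (a * hNum a) + k * (m ! * hNum a)
    ≡⟨ collect a (m !) (hNum a) k ⟩
  (a + k) * (m ! * hNum a)
    ≡⟨ cong (_* (m ! * hNum a)) (m+[n∸m]≡n a≤m+1) ⟩
  suc m * (m ! * hNum a)
    ≡⟨ sym (*-assoc (suc m) (m !) (hNum a)) ⟩
  suc m ! * hNum a ∎
  where
  open ≡-Reasoning
  k = suc m ∸ a
  closed = recordSum-closed m
  expand : ∀ a M f S k F → (a * M + S + k * F) * f ≡ M * (a * f) + S * f + k * (F * f)
  expand = solve-∀
  collect : ∀ a M H k → M * (a * H) + k * (M * H) ≡ (a + k) * (M * H)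
  collect = solve-∀
  -- the term with recordSum m a only matters when a ≤ m (otherwise k = 0)
  lastTerm : k * (recordSum m a * a !) ≡ k * (m ! * hNum a)
  lastTerm with m≤n⇒m<n∨m≡n a≤m+1
  ... | inj₁ (s≤s a≤m) = cong (k *_) (closed a a≤m)
  ... | inj₂ refl rewrite n∸n≡0 m = refl

harmonic-suc : ∀ n → harmonic (suc n) ≡ harmonic n ℚ.+ (pos 1) ℚ./ suc n
harmonic-suc n = begin
  foldr ℚ._+_ ℚ.0ℚ (map h (upTo (suc n)))
    ≡⟨ cong (λ L → foldr ℚ._+_ ℚ.0ℚ (map h L)) (sym (LP.upTo-∷ʳ n)) ⟩
  foldr ℚ._+_ ℚ.0ℚ (map h (upTo n ++ [ n ]))
    ≡⟨ cong (foldr ℚ._+_ ℚ.0ℚ) (LP.map-++ h (upTo n) [ n ]) ⟩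
  foldr ℚ._+_ ℚ.0ℚ (map h (upTo n) ++ [ h n ])
    ≡⟨ LP.foldr-++ ℚ._+_ ℚ.0ℚ (map h (upTo n)) [ h n ] ⟩
  foldr ℚ._+_ (h n ℚ.+ ℚ.0ℚ) (map h (upTo n))
    ≡⟨ cong (λ c → foldr ℚ._+_ c (map h (upTo n))) (ℚP.+-identityʳ (h n)) ⟩
  foldr ℚ._+_ (h n) (map h (upTo n))
    ≡⟨ foldr-init (h n) (map h (upTo n)) ⟩
  harmonic n ℚ.+ h n ∎
  where
  open ≡-Reasoning
  h : ℕ → ℚ
  h j = (pos 1) ℚ./ suc j
  foldr-init : ∀ c L → foldr ℚ._+_ c L ≡ foldr ℚ._+_ ℚ.0ℚ L ℚ.+ c
  foldr-init c [] = sym (ℚP.+-identityˡ c)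
  foldr-init c (x ∷ L) rewrite foldr-init c L = sym (ℚP.+-assoc x _ c)

+-unitFraction : ∀ A a D′ →
  mkℚᵘ (pos A) D′ ℚᵘ.+ mkℚᵘ (pos 1) a ℚᵘ.≃ mkℚᵘ (pos (A ℕ.* suc a ℕ.+ suc D′)) (D′ ℕ.+ a ℕ.* suc D′)
+-unitFraction A a D′ = *≡* (begin
  (pos A ℤ.* pos (suc a) ℤ.+ pos 1 ℤ.* pos (suc D′)) ℤ.* pos (suc (D′ ℕ.+ a ℕ.* suc D′))
    ≡⟨ cong (ℤ._* pos (suc (D′ ℕ.+ a ℕ.* suc D′))) numerator ⟩
  pos N ℤ.* pos (suc (D′ ℕ.+ a ℕ.* suc D′))
    ≡⟨ sym (ℤP.pos-* N _) ⟩
  pos (N ℕ.* suc (D′ ℕ.+ a ℕ.* suc D′))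
    ≡⟨ cong pos (denominators A a D′) ⟩
  pos (N ℕ.* (suc D′ ℕ.* suc a))
    ≡⟨ ℤP.pos-* N (suc D′ ℕ.* suc a) ⟩
  pos N ℤ.* pos (suc D′ ℕ.* suc a) ∎)
  where
  open ≡-Reasoning
  N = A ℕ.* suc a ℕ.+ suc D′
  numerator : pos A ℤ.* pos (suc a) ℤ.+ pos 1 ℤ.* pos (suc D′) ≡ pos N
  numerator = begin
    pos A ℤ.* pos (suc a) ℤ.+ pos 1 ℤ.* pos (suc D′)        ≡⟨ cong₂ ℤ._+_ (sym (ℤP.pos-* A (suc a))) (ℤP.*-identityˡ (pos (suc D′))) ⟩
    pos (A ℕ.* suc a) ℤ.+ pos (suc D′)                ≡⟨ sym (ℤP.pos-+ (A ℕ.* suc a) (suc D′)) ⟩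
    pos N                                        ∎
  denominators : ∀ A a D′ → (A ℕ.* suc a ℕ.+ suc D′) ℕ.* suc (D′ ℕ.+ a ℕ.* suc D′)
                          ≡ (A ℕ.* suc a ℕ.+ suc D′) ℕ.* (suc D′ ℕ.* suc a)
  denominators = solve-∀

harmonic≃ : ∀ n → ℚ.toℚᵘ (harmonic n) ℚᵘ.≃ mkℚᵘ (pos (hNum n)) (pred (n !))
harmonic≃ zero = ℚᵘP.≃-refl
harmonic≃ (suc n) rewrite harmonic-suc n =
  ℚᵘP.≃-trans (ℚP.toℚᵘ-homo-+ (harmonic n) ((pos 1) ℚ./ suc n))
   (ℚᵘP.≃-trans (ℚᵘP.+-cong (harmonic≃ n) (ℚP.toℚᵘ-fromℚᵘ (mkℚᵘ (pos 1) n)))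
     (step (n !) (1≤n! n)))
  where
  step : ∀ D → 1 ℕ.≤ D → mkℚᵘ (pos (hNum n)) (pred D) ℚᵘ.+ mkℚᵘ (pos 1) n
         ℚᵘ.≃ mkℚᵘ (pos (hNum n ℕ.* suc n ℕ.+ D)) (pred (suc n ℕ.* D))
  step (suc D′) _ = +-unitFraction (hNum n) n D′

harmonic≤mean : ∀ n (xs : List ℕ) → length xs ≡ n ! → hNum n ℕ.≤ foldr ℕ._+_ 0 xs →
  harmonic n ℚ.≤ mean xs
harmonic≤mean n (x ∷ xs) len hNum≤S = ℚP.toℚᵘ-cancel-≤
  (ℚᵘP.≤-respˡ-≃ (ℚᵘP.≃-sym (harmonic≃ n))
    (ℚᵘP.≤-respʳ-≃ (ℚᵘP.≃-sym (ℚP.toℚᵘ-fromℚᵘ (mkℚᵘ (pos S) (length xs)))) sameDenominator))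
  where
  S = foldr ℕ._+_ 0 (x ∷ xs)
  sameDenominator : mkℚᵘ (pos (hNum n)) (pred (n !)) ℚᵘ.≤ mkℚᵘ (pos S) (length xs)
  sameDenominator rewrite sym len = *≤* (subst₂ ℤ._≤_ (ℤP.pos-* (hNum n) _) (ℤP.pos-* S _)
    (ℤ.+≤+ (*-monoˡ-≤ (suc (length xs)) hNum≤S)))
harmonic≤mean n [] len _ = contradiction (subst (1 ℕ.≤_) (sym len) (1≤n! n)) λ ()

lookup-All : {P : A → Set} {xs : List A} → All P xs → (i : Fin (length xs)) → P (lookup xs i)
lookup-All pxs i = All.lookup pxs (∈P.∈-lookup i)

lookup-AllPairs : {R : A → A → Set} {xs : List A} → AllPairs R xs →
  (i j : Fin (length xs)) → toℕ i < toℕ j → R (lookup xs i) (lookup xs j)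
lookup-AllPairs (rx ∷ _) Fin.zero (Fin.suc j) _ = lookup-All rx j
lookup-AllPairs (_ ∷ rxs) (Fin.suc i) (Fin.suc j) (s≤s i<j) = lookup-AllPairs rxs i j i<j

∈⇒index : {x : A} {xs : List A} → x ∈ xs → Σ[ q ∈ Fin (length xs) ] lookup xs q ≡ x
∈⇒index x∈xs = Any.index x∈xs , sym (AnyP.lookup-index x∈xs)

lookup-map : (f : B → A) (xs : List B) (i : Fin (length xs)) →
  lookup (map f xs) (cast (sym (LP.length-map f xs)) i) ≡ f (lookup xs i)
lookup-map f (x ∷ xs) Fin.zero = refl
lookup-map f (x ∷ xs) (Fin.suc i) = lookup-map f xs i

index-order : ∀ {n} {xs : List (Fin n)} → AllPairs Fin._<_ xs →
  ∀ p q → lookup xs p Fin.< lookup xs q → toℕ p < toℕ q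
index-order {xs = xs} sorted p q v<w with <-cmp (toℕ p) (toℕ q)
... | tri< p<q _ _ = p<q
... | tri≈ _ p≡q _ rewrite FinP.toℕ-injective p≡q = contradiction v<w (<-irrefl refl)
... | tri> _ _ q<p = contradiction v<w (<⇒≯ (lookup-AllPairs sorted q p q<p))

emptyOrSnoc : (u : List A) → u ≡ [] ⊎ Σ[ v ∈ List A ] Σ[ a ∈ A ] u ≡ v ++ [ a ]
emptyOrSnoc u with initLast u
... | [] = inj₁ refl
... | v ∷ʳ′ a = inj₂ (v , a , refl)

parent-≤ : ∀ {k Y} (h : Heapable k Y) (i : Fin (length Y)) (u : Word k) (a : Fin k) →
  proj₁ h i ≡ u ++ [ a ] → Σ[ r ∈ Fin (length Y) ] toℕ r < toℕ i × lookup Y r ≤ lookup Y i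
parent-≤ (w , _ , tree , ordered) i u a wi≡ua with proj₁ (tree i u a wi≡ua)
... | r , wr≡u with ordered i r a (trans wi≡ua (cong (_++ [ a ]) (sym wr≡u)))
...   | Yr≤Yi , r<i = r , r<i , Yr≤Yi

-- Hence every entry other than the first has an earlier entry ≤ it: the node
-- of a later position is not the root, since the root is labelled by
-- position 0 (position 0 has no earlier position to be its parent).
earlier-≤ : ∀ k (Y : List ℕ) → Heapable k Y → (q : Fin (length Y)) → 0 < toℕ q →
  Σ[ r ∈ Fin (length Y) ] toℕ r < toℕ q × lookup Y r ≤ lookup Y q
earlier-≤ k (y ∷ ys) h@(w , injective , _) q 0<q with emptyOrSnoc (w q)
... | inj₂ (u , a , wq≡ua) = parent-≤ h q u a wq≡ua
... | inj₁ wq≡[] with emptyOrSnoc (w Fin.zero)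
...   | inj₁ w0≡[] = contradiction (cong toℕ (injective (trans w0≡[] (sym wq≡[])))) (<⇒≢ 0<q)
...   | inj₂ (u , a , w0≡ua) with parent-≤ h Fin.zero u a w0≡ua
...     | _ , () , _

earlier-≤-map : ∀ k (f : B → ℕ) (L : List B) → Heapable k (map f L) →
  (q : Fin (length L)) → 0 < toℕ q →
  Σ[ r ∈ Fin (length L) ] toℕ r < toℕ q × f (lookup L r) ≤ f (lookup L q)
earlier-≤-map k f L h q 0<q
  with earlier-≤ k (map f L) h (cast (sym (LP.length-map f L)) q) (subst (0 <_) (sym (FinP.toℕ-cast _ q)) 0<q)
... | r′ , r′<q , fr≤fq =
  cast len r′ ,
  subst₂ _<_ (sym (FinP.toℕ-cast len r′)) (FinP.toℕ-cast _ q) r′<q ,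
  subst₂ _≤_ lookup-r′ (lookup-map f L q) fr≤fq
  where
  len = LP.length-map f L
  lookup-r′ : lookup (map f L) r′ ≡ f (lookup L (cast len r′))
  lookup-r′ = trans (cong (lookup (map f L)) (sym (FinP.cast-involutive _ len r′))) (lookup-map f L (cast len r′))

module _ (X : List ℕ) {m : ℕ} (c : Fin (length X) → Fin m) where

  members : Fin m → List (Fin (length X))
  members t = filter (λ i → c i Fin.≟ t) (allFin (length X))

  members-sorted : ∀ t → AllPairs Fin._<_ (members t)
  members-sorted t = AllPairsP.filter⁺ _ (AllPairsP.tabulate⁺-< (λ i<j → i<j))

  ∈-members : ∀ {i t} → c i ≡ t → i ∈ members t
  ∈-members {i} ci≡t = ∈P.∈-filter⁺ _ (∈P.∈-allFin i) ci≡t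

  sameClass-≤ : ∀ k → (∀ t → Heapable k (subseq X c t)) → ∀ i j → toℕ i < toℕ j → c i ≡ c j →
    Σ[ r ∈ Fin (length X) ] toℕ r < toℕ j × lookup X r ≤ lookup X j
  sameClass-≤ k heap i j i<j ci≡cj
    with ∈⇒index (∈-members ci≡cj) | ∈⇒index (∈-members {j} refl)
  ... | qi , Lqi≡i | qj , Lqj≡j
    with earlier-≤-map k (lookup X) (members (c j)) (heap (c j)) qj
           (≤-<-trans z≤n (index-order (members-sorted (c j)) qi qj (subst₂ Fin._<_ (sym Lqi≡i) (sym Lqj≡j) i<j)))
  ... | r , r<qj , Xr≤Xj =
    lookup (members (c j)) r ,
    subst (λ x → toℕ (lookup (members (c j)) r) < toℕ x) Lqj≡j (lookup-AllPairs (members-sorted (c j)) r qj r<qj) ,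
    subst (λ x → lookup X (lookup (members (c j)) r) ≤ lookup X x) Lqj≡j Xr≤Xj

IsMinimumBelow : ℕ → (X : List ℕ) → Fin (length X) → Set
IsMinimumBelow b X p = lookup X p < b × (∀ r → toℕ r < toℕ p → lookup X p < lookup X r)

minimaBelow : ℕ → (X : List ℕ) → List (Fin (length X))
minimaBelow b [] = []
minimaBelow b (y ∷ ys) =
  if y <ᵇ b then Fin.zero ∷ map Fin.suc (minimaBelow y ys) else map Fin.suc (minimaBelow b ys)

length-minimaBelow : ∀ b X → length (minimaBelow b X) ≡ records b X
length-minimaBelow b [] = refl
length-minimaBelow b (y ∷ ys) with y <ᵇ b
... | true = cong suc (trans (LP.length-map Fin.suc (minimaBelow y ys)) (length-minimaBelow y ys))
... | false = trans (LP.length-map Fin.suc (minimaBelow b ys)) (length-minimaBelow b ys)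

minimaBelow-sorted : ∀ b X → AllPairs Fin._<_ (minimaBelow b X)
minimaBelow-sorted b [] = []
minimaBelow-sorted b (y ∷ ys) with y <ᵇ b
... | true = AllP.map⁺ (All.universal (λ _ → s≤s z≤n) _) ∷ AllPairsP.map⁺ (AllPairs.map s≤s (minimaBelow-sorted y ys))
... | false = AllPairsP.map⁺ (AllPairs.map s≤s (minimaBelow-sorted b ys))

minimaBelow-minima : ∀ b X → All (IsMinimumBelow b X) (minimaBelow b X)
minimaBelow-minima b [] = []
minimaBelow-minima b (y ∷ ys) with y <ᵇ b | <ᵇ-reflects-< y b
... | true | ofʸ y<b = (y<b , λ r ()) ∷ AllP.map⁺ (All.map shift (minimaBelow-minima y ys))
  where
  shift : ∀ {p} → IsMinimumBelow y ys p → IsMinimumBelow b (y ∷ ys) (Fin.suc p)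
  shift (Xp<y , minimal) = <-trans Xp<y y<b , λ { Fin.zero _ → Xp<y ; (Fin.suc r) (s≤s r<p) → minimal r r<p }
... | false | ofⁿ y≮b = AllP.map⁺ (All.map shift (minimaBelow-minima b ys))
  where
  shift : ∀ {p} → IsMinimumBelow b ys p → IsMinimumBelow b (y ∷ ys) (Fin.suc p)
  shift (Xp<b , minimal) = Xp<b , λ { Fin.zero _ → <-≤-trans Xp<b (≮⇒≥ y≮b) ; (Fin.suc r) (s≤s r<p) → minimal r r<p }

-- MHS lower bound: two left-to-right minima never share a heapable class, so
-- a partition into m heapable subsequences has m ≥ records b X.
records≤parts : ∀ k X m b → PartitionableInto k X m → records b X ≤ m
records≤parts k X m b (c , heap) =
  subst (_≤ m) (length-minimaBelow b X) (≮⇒≥ noCollision)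
  where
  L = minimaBelow b X
  noCollision : ¬ (m < length L)
  noCollision m<|L| with FinP.pigeonhole m<|L| (λ a → c (lookup L a))
  ... | a₁ , a₂ , a₁<a₂ , same
    with sameClass-≤ X c k heap (lookup L a₁) (lookup L a₂) (lookup-AllPairs (minimaBelow-sorted b X) a₁ a₂ a₁<a₂) same
  ... | r , r<p , Xr≤Xp = <-irrefl refl (<-≤-trans (proj₂ (lookup-All (minimaBelow-minima b X) a₂) r r<p) Xr≤Xp)

entries : ℕ → List ℕ
entries n = map suc (upTo n)

entries-unique : ∀ n → Unique (entries n)
entries-unique n = UniqueP.map⁺ suc-injective (UniqueP.upTo⁺ n)

length-entries : ∀ n → length (entries n) ≡ n
length-entries n = trans (LP.length-map suc (upTo n)) (LP.length-upTo n)

below-entries : ∀ n → below (suc n) (entries n) ≡ n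
below-entries n = trans (below-all (entries n) (AllP.map⁺ (AllP.applyUpTo⁺₁ (λ j → j) n s≤s))) (length-entries n)

Σ-perms : ∀ n (f : List ℕ → ℕ) → Σ (perms n) f ≡ Σinj (entries n) n f
Σ-perms n f = Σ-filter (UniqueDec.unique? _≟_) (seqsOver (entries n) n) f

length-perms : ∀ n → length (perms n) ≡ n !
length-perms n = begin
  length (perms n)                ≡⟨ sym (*-identityʳ _) ⟩
  length (perms n) * 1            ≡⟨ sym (Σ-const (perms n) 1) ⟩
  Σ (perms n) (λ _ → 1)           ≡⟨ Σ-perms n (λ _ → 1) ⟩
  Σinj (entries n) n (λ _ → 1)    ≡⟨ Σinj-count n (entries n) (entries-unique n) (length-entries n) ⟩
  n !                             ∎
  where open ≡-Reasoning

Σ-perms-records : ∀ n → Σ (perms n) (records (suc n)) ≡ hNum n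
Σ-perms-records n = *-cancelʳ-≡ _ _ (n !) {{n !≢0}} (begin
  Σ (perms n) (records (suc n)) * n !                   ≡⟨ cong (_* n !) (Σ-perms n (records (suc n))) ⟩
  Σinj (entries n) n (records (suc n)) * n !            ≡⟨ cong (_* n !) (Σinj-records n (entries n) (entries-unique n) (length-entries n) (suc n)) ⟩
  recordSum n (below (suc n) (entries n)) * n !         ≡⟨ cong (λ a → recordSum n a * n !) (below-entries n) ⟩
  recordSum n n * n !                                   ≡⟨ recordSum-closed n n ≤-refl ⟩
  n ! * hNum n                                          ≡⟨ *-comm (n !) (hNum n) ⟩
  hNum n * n !                                          ∎)
  where open ≡-Reasoning

theorem4 : (k n : ℕ) → 1 ≤ k → 1 ≤ n →
    (mhs : List ℕ → ℕ) → All (λ π → IsMHS k π (mhs π)) (perms n) →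
    harmonic n ℚ.≤ mean (map mhs (perms n))
theorem4 k n _ _ mhs isMHS =
  harmonic≤mean n (map mhs (perms n)) (trans (LP.length-map mhs (perms n)) (length-perms n)) sumBound
  where
  mhs≥records : All (λ π → records (suc n) π ≤ mhs π) (perms n)
  mhs≥records = All.map (λ {π} isMHSπ → records≤parts k π (mhs π) (suc n) (proj₁ isMHSπ)) isMHS
  sumBound : hNum n ≤ Σ (perms n) mhs
  sumBound = begin
    hNum n                         ≡⟨ sym (Σ-perms-records n) ⟩
    Σ (perms n) (records (suc n))  ≤⟨ Σ-mono (perms n) mhs≥records ⟩
    Σ (perms n) mhs                ∎
    where open ≤-Reasoning
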